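{- For all integers $i\geq 4$ and $j\geq 1$, White has a winning strategy in Multimove Chess $(i,j)$.
   Context: For positive integers $i,j$, Multimove Chess $(i,j)$ is the game played with exactly the rules of standard chess (standard starting position, standard piece moves, White plays first), except that on each of its turns White makes $i$ consecutive moves and on each of its turns Black makes $j$ consecutive moves. A side wins when it captures the opponent's king. A side "has a winning strategy" if it has a strategy guaranteed to win regardless of the opponent's play. -}

module Defs where

-- Multimove Chess (i , j): standard chess rules, White makes i consecutive
-- moves per turn, Black j; a side wins by capturing the opponent's king.
-- Moves are pseudo-legal (no check rules: a king may be left en prise,
-- since the game is won by capturing it).

open import Data.Bool using (Bool; true; false; _∧_; _∨_; not; if_then_else_; T)
open import Data.Nat using (ℕ; zero; suc; _≡ᵇ_; _<?_; _⊔_; _∸_)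
open import Data.Integer as Z using (ℤ; +_; -[1+_]; ∣_∣)
open import Data.Fin using (Fin; toℕ; fromℕ<)
open import Data.Maybe using (Maybe; just; nothing)
open import Data.Product using (_×_; _,_; proj₁; proj₂; ∃)
open import Data.List using (List; []; _∷_; allFin; cartesianProduct)
open import Data.Bool.ListAction using (any)
open import Relation.Nullary.Decidable using (⌊_⌋; yes; no)
open import Relation.Binary.PropositionalEquality using (_≡_)

data Color : Set where
  white black : Color

opp : Color → Color
opp white = black
opp black = white

_==c_ : Color → Color → Bool
white ==c white = true
black ==c black = true
_     ==c _     = false

data Kind : Set where
  pawn knight bishop rook queen king : Kind

kindIdx : Kind → ℕ
kindIdx pawn   = 0
kindIdx knight = 1
kindIdx bishop = 2
kindIdx rook   = 3
kindIdx queen  = 4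
kindIdx king   = 5

_==k_ : Kind → Kind → Bool
k ==k k' = kindIdx k ≡ᵇ kindIdx k'

record Piece : Set where
  constructor piece
  field
    color : Color
    kind  : Kind
open Piece public

-- Squares: (file , rank), both 0-indexed; file 0 = a, rank 0 = rank 1
-- (White's back rank).

Square : Set
Square = Fin 8 × Fin 8

file rank : Square → ℕ
file s = toℕ (proj₁ s)
rank s = toℕ (proj₂ s)

_==s_ : Square → Square → Bool
s ==s t = (file s ≡ᵇ file t) ∧ (rank s ≡ᵇ rank t)

toFin8 : ℤ → Maybe (Fin 8)
toFin8 (+ n) with n <? 8
... | yes p = just (fromℕ< p)
... | no  _ = nothing
toFin8 -[1+ _ ] = nothing

mkSq : ℤ → ℤ → Maybe Square
mkSq x y with toFin8 x | toFin8 y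
... | just f | just r = just (f , r)
... | _      | _      = nothing

allSquares : List Square
allSquares = cartesianProduct (allFin 8) (allFin 8)

fileZ rankZ : Square → ℤ
fileZ s = + file s
rankZ s = + rank s

_==z_ : ℤ → ℤ → Bool
x ==z y = ⌊ x Z.≟ y ⌋

sgn : ℤ → ℤ
sgn (+ zero)  = + 0
sgn (+ suc _) = + 1
sgn -[1+ _ ]  = -[1+ 0 ]

Board : Set
Board = Square → Maybe Piece

setSq : Board → Square → Maybe Piece → Board
setSq b s x t = if s ==s t then x else b t

isEmpty : Board → Square → Bool
isEmpty b s with b s
... | nothing = true
... | just _  = false

hasPiece : Board → Square → Color → Kind → Bool
hasPiece b s c k with b s
... | nothing = false
... | just (piece c' k') = (c ==c c') ∧ (k ==k k')

hasColor : Board → Square → Color → Bool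
hasColor b s c with b s
... | nothing = false
... | just (piece c' _) = c ==c c'

data Wing : Set where
  kingside queenside : Wing

record Position : Set where
  field
    board  : Board
    castle : Color → Wing → Bool
    ep     : Maybe Square          -- en-passant target square (square passed over
                                   -- by a pawn double step made on the previous move)
    toMove : Color
    left   : ℕ                     -- moves remaining in the current turn
open Position public

backRankKind : ℕ → Kind
backRankKind 0 = rook
backRankKind 1 = knight
backRankKind 2 = bishop
backRankKind 3 = queen
backRankKind 4 = king
backRankKind 5 = bishop
backRankKind 6 = knight
backRankKind _ = rook

initialBoardℕ : ℕ → ℕ → Maybe Piece
initialBoardℕ f 0 = just (piece white (backRankKind f))
initialBoardℕ f 1 = just (piece white pawn)
initialBoardℕ f 6 = just (piece black pawn)
initialBoardℕ f 7 = just (piece black (backRankKind f))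
initialBoardℕ f _ = nothing

initialBoard : Board
initialBoard s = initialBoardℕ (file s) (rank s)

initial : ℕ → Position
initial i = record
  { board  = initialBoard
  ; castle = λ _ _ → true
  ; ep     = nothing
  ; toMove = white
  ; left   = i
  }

record Move : Set where
  constructor mv
  field
    from  : Square
    to    : Square
    promo : Maybe Kind
open Move public

homeRank : Color → ℕ
homeRank white = 0
homeRank black = 7

lastRank : Color → ℕ
lastRank white = 7
lastRank black = 0

pawnStartRank : Color → ℕ
pawnStartRank white = 1
pawnStartRank black = 6

pawnDir : Color → ℤ
pawnDir white = + 1
pawnDir black = -[1+ 0 ]

emptyAtZ : Board → ℤ → ℤ → Bool
emptyAtZ b x y with mkSq x y
... | just q  = isEmpty b q
... | nothing = false

clear : Board → Square → Square → Bool
clear b s t = go (((∣ dx ∣) ⊔ (∣ dy ∣)) ∸ 1)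
  where
  dx = fileZ t Z.- fileZ s
  dy = rankZ t Z.- rankZ s
  sx = sgn dx
  sy = sgn dy
  go : ℕ → Bool
  go zero    = true
  go (suc n) = emptyAtZ b (fileZ s Z.+ sx Z.* + suc n) (rankZ s Z.+ sy Z.* + suc n) ∧ go n

dfile drank : Square → Square → ℤ
dfile s t = fileZ t Z.- fileZ s
drank s t = rankZ t Z.- rankZ s

adf adr : Square → Square → ℕ
adf s t = ∣ dfile s t ∣
adr s t = ∣ drank s t ∣

knightGeom diagGeom orthGeom kingGeom : Square → Square → Bool
knightGeom s t = ((adf s t ≡ᵇ 1) ∧ (adr s t ≡ᵇ 2)) ∨ ((adf s t ≡ᵇ 2) ∧ (adr s t ≡ᵇ 1))
diagGeom s t = (adf s t ≡ᵇ adr s t) ∧ not (adf s t ≡ᵇ 0)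
orthGeom s t = ((adf s t ≡ᵇ 0) ∧ not (adr s t ≡ᵇ 0)) ∨ ((adr s t ≡ᵇ 0) ∧ not (adf s t ≡ᵇ 0))
kingGeom s t = (adf s t ⊔ adr s t) ≡ᵇ 1

attacksFrom : Board → Square → Square → Bool
attacksFrom b s t with b s
... | nothing = false
... | just (piece c pawn)   = (adf s t ≡ᵇ 1) ∧ (drank s t ==z pawnDir c)
... | just (piece c knight) = knightGeom s t
... | just (piece c bishop) = diagGeom s t ∧ clear b s t
... | just (piece c rook)   = orthGeom s t ∧ clear b s t
... | just (piece c queen)  = (diagGeom s t ∨ orthGeom s t) ∧ clear b s t
... | just (piece c king)   = kingGeom s t

attackedBy : Board → Color → Square → Bool
attackedBy b c t = any (λ s → hasColor b s c ∧ attacksFrom b s t) allSquares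

sqAt : ℕ → ℕ → Square
sqAt f r with mkSq (+ f) (+ r)
... | just q  = q
... | nothing = (Data.Fin.zero , Data.Fin.zero)

wingRookFile : Wing → ℕ
wingRookFile kingside  = 7
wingRookFile queenside = 0

castleOK : Position → Color → Square → Square → Bool
castleOK p c s t =
  (rank s ≡ᵇ h) ∧ (rank t ≡ᵇ h) ∧ (file s ≡ᵇ 4) ∧
  ( ((file t ≡ᵇ 6) ∧ castle p c kingside ∧ hasPiece b (sqAt 7 h) c rook
       ∧ isEmpty b (sqAt 5 h) ∧ isEmpty b (sqAt 6 h)
       ∧ safe 4 ∧ safe 5 ∧ safe 6)
  ∨ ((file t ≡ᵇ 2) ∧ castle p c queenside ∧ hasPiece b (sqAt 0 h) c rook
       ∧ isEmpty b (sqAt 1 h) ∧ isEmpty b (sqAt 2 h) ∧ isEmpty b (sqAt 3 h)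
       ∧ safe 4 ∧ safe 3 ∧ safe 2))
  where
  h = homeRank c
  b = board p
  safe : ℕ → Bool
  safe f = not (attackedBy b (opp c) (sqAt f h))

isEpCapture : Position → Color → Square → Square → Bool
isEpCapture p c s t with ep p
... | nothing = false
... | just e  = (e ==s t) ∧ isEmpty (board p) t
                ∧ hasPiece (board p) (sqAt (file t) (rank s)) (opp c) pawn

pawnOK : Position → Color → Square → Square → Bool
pawnOK p c s t =
  ((adf s t ≡ᵇ 0) ∧ (drank s t ==z d) ∧ isEmpty b t)
  ∨ ((adf s t ≡ᵇ 0) ∧ (drank s t ==z (d Z.+ d)) ∧ (rank s ≡ᵇ pawnStartRank c)
       ∧ isEmpty b t ∧ emptyAtZ b (fileZ s) (rankZ s Z.+ d))
  ∨ ((adf s t ≡ᵇ 1) ∧ (drank s t ==z d)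
       ∧ (hasColor b t (opp c) ∨ isEpCapture p c s t))
  where
  b = board p
  d = pawnDir c

isPromoKind : Kind → Bool
isPromoKind knight = true
isPromoKind bishop = true
isPromoKind rook   = true
isPromoKind queen  = true
isPromoKind _      = false

promoOK : Color → Kind → Square → Maybe Kind → Bool
promoOK c pawn t (just k) = (rank t ≡ᵇ lastRank c) ∧ isPromoKind k
promoOK c pawn t nothing  = not (rank t ≡ᵇ lastRank c)
promoOK c _    t (just _) = false
promoOK c _    t nothing  = true

kindOK : Position → Color → Kind → Square → Square → Bool
kindOK p c pawn   s t = pawnOK p c s t
kindOK p c knight s t = knightGeom s t
kindOK p c bishop s t = diagGeom s t ∧ clear (board p) s t
kindOK p c rook   s t = orthGeom s t ∧ clear (board p) s t
kindOK p c queen  s t = (diagGeom s t ∨ orthGeom s t) ∧ clear (board p) s t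
kindOK p c king   s t = kingGeom s t ∨ castleOK p c s t

legal : Position → Move → Bool
legal p m with board p (from m)
... | nothing = false
... | just (piece c k) =
      (c ==c toMove p) ∧ not (hasColor (board p) (to m) c)
      ∧ kindOK p c k (from m) (to m) ∧ promoOK c k (to m) (promo m)

capturesKing : Position → Move → Bool
capturesKing p m = hasPiece (board p) (to m) (opp (toMove p)) king

apply : ℕ → ℕ → Position → Move → Position
apply i j p m with board p (from m)
... | nothing = p
... | just (piece c k) = record
  { board  = b3
  ; castle = λ c' w → castle p c' w
                      ∧ not (touches (sqAt 4 (homeRank c')))
                      ∧ not (touches (sqAt (wingRookFile w) (homeRank c')))
  ; ep     = if (k ==k pawn) ∧ (adr s t ≡ᵇ 2)
               then mkSq (fileZ s) (rankZ s Z.+ pawnDir c) else nothing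
  ; toMove = if left p Data.Nat.≤ᵇ 1 then opp c else c
  ; left   = if left p Data.Nat.≤ᵇ 1 then turnLength (opp c) else left p ∸ 1
  }
  where
  b = board p
  s = from m
  t = to m
  h = homeRank c
  newPiece : Piece
  newPiece with promo m
  ... | just k' = piece c k'
  ... | nothing = piece c k
  b1 = setSq (setSq b s nothing) t (just newPiece)
  -- en passant: remove the captured pawn
  b2 = if (k ==k pawn) ∧ not (adf s t ≡ᵇ 0) ∧ isEmpty b t
         then setSq b1 (sqAt (file t) (rank s)) nothing else b1
  b3 = if (k ==k king) ∧ (adf s t ≡ᵇ 2)
         then (if file t ≡ᵇ 6
                 then setSq (setSq b2 (sqAt 7 h) nothing) (sqAt 5 h) (b (sqAt 7 h))
                 else setSq (setSq b2 (sqAt 0 h) nothing) (sqAt 3 h) (b (sqAt 0 h)))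
         else b2
  touches : Square → Bool
  touches q = (q ==s s) ∨ (q ==s t)
  turnLength : Color → ℕ
  turnLength white = i
  turnLength black = j

-- A strategy chooses a move given the current position and the history
-- of moves played so far (most recent first).
Strategy : Set
Strategy = Position → List Move → Move

data State : Set where
  playing  : Position → List Move → State
  whiteWon : State
  blackWon : State
  stuck    : State   -- the side to move produced no legal move (game ends, no win)

step : ℕ → ℕ → Strategy → Strategy → State → State
step i j σ τ (playing p h) =
  if legal p m
    then (if capturesKing p m then winner (toMove p) else playing (apply i j p m) (m ∷ h))
    else stuck
  where
  mover : Color → Strategy
  mover white = σ
  mover black = τ
  m = mover (toMove p) p h
  winner : Color → State
  winner white = whiteWon
  winner black = blackWon
step i j σ τ s = s

run : ℕ → ℕ → Strategy → Strategy → ℕ → State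
run i j σ τ zero    = playing (initial i) []
run i j σ τ (suc n) = step i j σ τ (run i j σ τ n)

AdmissibleBlack : Strategy → Set
AdmissibleBlack τ = ∀ p h → toMove p ≡ black → ∃ (λ m → T (legal p m)) → T (legal p (τ p h))

WhiteHasWinningStrategy : ℕ → ℕ → Set
WhiteHasWinningStrategy i j =
  ∃ λ (σ : Strategy) → ∀ (τ : Strategy) → AdmissibleBlack τ → ∃ λ n → run i j σ τ n ≡ whiteWon

module Submission where

-- White needs only its first turn: e3 opens the d1–h5 diagonal, and Qh5, Qxf7,
-- Qxe8 captures the king.  With i ≥ 4 all four moves fall in that turn, so Black
-- never moves and its strategy is irrelevant.

open import Defs
open import Data.Nat using (ℕ; _+_; _≤_; s≤s; z≤n)
open import Data.List using ([]; _∷_)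
open import Data.Maybe using (nothing)
open import Data.Product using (_,_)
open import Relation.Binary.PropositionalEquality using (_≡_; refl)

e2-e3 Qd1-h5 Qh5xf7 Qf7xe8 : Move
e2-e3  = mv (sqAt 4 1) (sqAt 4 2) nothing
Qd1-h5 = mv (sqAt 3 0) (sqAt 7 4) nothing
Qh5xf7 = mv (sqAt 7 4) (sqAt 5 6) nothing
Qf7xe8 = mv (sqAt 5 6) (sqAt 4 7) nothing

queenRaid : Strategy
queenRaid _ []           = e2-e3
queenRaid _ (_ ∷ [])     = Qd1-h5
queenRaid _ (_ ∷ _ ∷ []) = Qh5xf7
queenRaid _ _            = Qf7xe8

queenRaid-wins-in-4 : ∀ k j τ → run (4 + k) j queenRaid τ 4 ≡ whiteWon
queenRaid-wins-in-4 k j τ = refl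

lemma6 : ∀ (i j : ℕ) → 4 ≤ i → 1 ≤ j → WhiteHasWinningStrategy i j
lemma6 _ j (s≤s (s≤s (s≤s (s≤s {n = k} z≤n)))) _ =
  queenRaid , λ τ _ → 4 , queenRaid-wins-in-4 k j τ
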